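{- For every $n \geq 4$ there exists a graph $G$ on $n$ vertices with $\delta(G) = \lfloor n/2 \rfloor$ and $m(G, 3) > 3$.
   Context: Graphs are finite and simple; $\delta(G)$ is the minimum degree and $N(v)$ the neighbourhood of $v$. For an integer $r \geq 2$, the $r$-neighbour bootstrap process on $G$ started from $A \subseteq V(G)$ is defined by $A_0 = A$ and $A_t = A_{t-1} \cup \{v \in V(G) : |N(v) \cap A_{t-1}| \geq r\}$ for $t \geq 1$. The closure is $\langle A \rangle_r = \bigcup_{t \geq 0} A_t$. The set $A$ percolates if $\langle A \rangle_r = V(G)$. Define $m(G,r) = \min\{|A| : A \subseteq V(G),\ \langle A \rangle_r = V(G)\}$. -}

module Defs where

open import Data.Nat using (ℕ; zero; suc; _≤_; _<_; _/_; _≤ᵇ_)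
open import Data.Bool using (Bool; true; false; _∧_; _∨_; if_then_else_)
open import Data.Fin using (Fin)
open import Data.Fin.Subset using (Subset; _∈_; ∣_∣)
open import Data.Vec using (tabulate; lookup)
open import Data.List using (List; map)
open import Data.Nat.ListAction using (sum)
open import Data.Vec.Base using (toList; allFin)
open import Data.Product using (Σ; ∃; _×_)
open import Relation.Binary.PropositionalEquality using (_≡_)

record Graph (n : ℕ) : Set where
  field
    adj   : Fin n → Fin n → Bool
    sym   : ∀ u v → adj u v ≡ adj v u
    irrefl : ∀ v → adj v v ≡ false
open Graph public

countV : ∀ {n} → (Fin n → Bool) → ℕ
countV {n} p = sum (map (λ v → if p v then 1 else 0) (toList (allFin n)))

deg : ∀ {n} → Graph n → Fin n → ℕ
deg G v = countV (adj G v)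

MinDegree : ∀ {n} → Graph n → ℕ → Set
MinDegree {n} G d = (∀ v → d ≤ deg G v) × ∃ λ v → deg G v ≡ d

nbrsIn : ∀ {n} → Graph n → Subset n → Fin n → ℕ
nbrsIn G S v = countV (λ u → adj G v u ∧ lookup S u)

step : ∀ {n} → ℕ → Graph n → Subset n → Subset n
step r G S = tabulate (λ v → lookup S v ∨ (r ≤ᵇ nbrsIn G S v))

stage : ∀ {n} → ℕ → Graph n → Subset n → ℕ → Subset n
stage r G A zero    = A
stage r G A (suc t) = step r G (stage r G A t)

InClosure : ∀ {n} → ℕ → Graph n → Subset n → Fin n → Set
InClosure r G A v = ∃ λ t → v ∈ stage r G A t

Percolates : ∀ {n} → ℕ → Graph n → Subset n → Set
Percolates r G A = ∀ v → InClosure r G A v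

-- m(G,r) > k : every percolating set has more than k elements
-- (m(G,r) is the minimum size of a percolating set; V(G) percolates, so the
-- minimum exists and m(G,r) > k iff no percolating set has size ≤ k)
PercNumberGreaterThan : ∀ {n} → Graph n → ℕ → ℕ → Set
PercNumberGreaterThan {n} G r k = ∀ (A : Subset n) → Percolates r G A → k < ∣ A ∣

-- The graph is two disjoint cliques on {0,…,k-1} and {k,…,n-1}, k = ⌊n/2⌋, joined by
-- the matching i — i+k. Each vertex of the first clique has k-1 neighbours inside and
-- one outside, so δ = k. Every vertex has at most one neighbour across the cut, so in
-- 3-neighbour bootstrap percolation a clique containing at most one initially infected
-- vertex never gains another: a percolating set needs two vertices in each clique.
module Submission where

open import Defs
open import Data.Nat as ℕ using (ℕ; _≤_; _/_; zero; suc; _+_; _∸_; _<_; _<ᵇ_; z≤n; s≤s; s≤s⁻¹; _≤?_; _<?_)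
open import Data.Nat.Properties hiding (_≟_)
open import Data.Nat.DivMod using (m/n*n≤m; /-mono-≤)
open import Data.Nat.ListAction using (sum)
open import Data.Bool using (Bool; true; false; _∧_; T; if_then_else_)
open import Data.Bool.Properties using (T-∨; T-≡)
open import Data.Fin using (Fin; toℕ; fromℕ<; _≟_)
open import Data.Fin.Properties using (toℕ-injective; toℕ-fromℕ<; toℕ<n)
open import Data.Fin.Subset
open import Data.Fin.Subset.Properties
open import Data.List using (map)
open import Data.Vec as Vec using (Vec; []; _∷_; lookup; tabulate; toList; allFin)
open import Data.Vec.Properties using (lookup∘tabulate; tabulate-allFin; []=⇒lookup; lookup⇒[]=)
open import Data.Product using (Σ; _×_; _,_; proj₁; proj₂; swap)
open import Data.Sum as Sum using (_⊎_; inj₁; inj₂)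
open import Function.Base using (_∘_)
open import Function.Bundles using (Equivalence; mk⇔)
open import Relation.Binary.PropositionalEquality as ≡ hiding (sym)
open import Relation.Nullary using (yes; no; contradiction)
open import Relation.Nullary.Decidable
  using (Dec; isYes; isYes≗does; does-⇔; dec-false; toWitness; fromWitness; _×-dec_; _⊎-dec_; ¬?)

private
  variable
    n : ℕ
    p q : Subset n
    x y : Fin n

∣p∪q∣≤∣p∣+∣q∣ : ∀ (p q : Subset n) → ∣ p ∪ q ∣ ≤ ∣ p ∣ + ∣ q ∣
∣p∪q∣≤∣p∣+∣q∣ []            []            = z≤n
∣p∪q∣≤∣p∣+∣q∣ (true  ∷ p)   (b     ∷ q)   =
  s≤s (≤-trans (∣p∪q∣≤∣p∣+∣q∣ p q) (+-monoʳ-≤ ∣ p ∣ (∣p∣≤∣x∷p∣ b q)))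
∣p∪q∣≤∣p∣+∣q∣ (false ∷ p)   (true  ∷ q)   =
  ≤-trans (s≤s (∣p∪q∣≤∣p∣+∣q∣ p q)) (≤-reflexive (≡.sym (+-suc ∣ p ∣ ∣ q ∣)))
∣p∪q∣≤∣p∣+∣q∣ (false ∷ p)   (false ∷ q)   = ∣p∪q∣≤∣p∣+∣q∣ p q

∣p∣≡∣p∩q∣+∣p∩∁q∣ : ∀ (p q : Subset n) → ∣ p ∣ ≡ ∣ p ∩ q ∣ + ∣ p ∩ ∁ q ∣
∣p∣≡∣p∩q∣+∣p∩∁q∣ []          []          = refl
∣p∣≡∣p∩q∣+∣p∩∁q∣ (true  ∷ p) (true  ∷ q) = cong suc (∣p∣≡∣p∩q∣+∣p∩∁q∣ p q)
∣p∣≡∣p∩q∣+∣p∩∁q∣ (true  ∷ p) (false ∷ q) =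
  trans (cong suc (∣p∣≡∣p∩q∣+∣p∩∁q∣ p q)) (≡.sym (+-suc ∣ p ∩ q ∣ ∣ p ∩ ∁ q ∣))
∣p∣≡∣p∩q∣+∣p∩∁q∣ (false ∷ p) (true  ∷ q) = ∣p∣≡∣p∩q∣+∣p∩∁q∣ p q
∣p∣≡∣p∩q∣+∣p∩∁q∣ (false ∷ p) (false ∷ q) = ∣p∣≡∣p∩q∣+∣p∩∁q∣ p q

p⊆q∪⁅x⁆⇒∣p∣≤1+∣q∣ : p ⊆ q ∪ ⁅ x ⁆ → ∣ p ∣ ≤ suc ∣ q ∣
p⊆q∪⁅x⁆⇒∣p∣≤1+∣q∣ {p = p} {q = q} {x = x} p⊆q∪x = begin
  ∣ p ∣               ≤⟨ p⊆q⇒∣p∣≤∣q∣ p⊆q∪x ⟩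
  ∣ q ∪ ⁅ x ⁆ ∣       ≤⟨ ∣p∪q∣≤∣p∣+∣q∣ q ⁅ x ⁆ ⟩
  ∣ q ∣ + ∣ ⁅ x ⁆ ∣   ≡⟨ cong (∣ q ∣ +_) (∣⁅x⁆∣≡1 x) ⟩
  ∣ q ∣ + 1           ≡⟨ +-comm ∣ q ∣ 1 ⟩
  suc ∣ q ∣           ∎
  where open ≤-Reasoning

p∪⁅x⁆⊆q∪⁅y⁆⇒∣p∣≤∣q∣ : x ∉ p → p ∪ ⁅ x ⁆ ⊆ q ∪ ⁅ y ⁆ → ∣ p ∣ ≤ ∣ q ∣
p∪⁅x⁆⊆q∪⁅y⁆⇒∣p∣≤∣q∣ {x = x} {p = p} {q = q} x∉p p∪x⊆q∪y = s≤s⁻¹ (begin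
  suc ∣ p ∣        ≤⟨ p⊂q⇒∣p∣<∣q∣ (p⊆p∪q ⁅ x ⁆ , x , x∈p∪q⁺ (inj₂ (x∈⁅x⁆ x)) , x∉p) ⟩
  ∣ p ∪ ⁅ x ⁆ ∣    ≤⟨ p⊆q∪⁅x⁆⇒∣p∣≤1+∣q∣ p∪x⊆q∪y ⟩
  suc ∣ q ∣        ∎)
  where open ≤-Reasoning

∣p∣≤1 : ∀ {n} {p : Subset n} → (∀ {x y} → x ∈ p → y ∈ p → x ≡ y) → ∣ p ∣ ≤ 1
∣p∣≤1 {n = n} {p = p} unique with nonempty? p
... | yes (x , x∈p) = ≤-trans (p⊆q⇒∣p∣≤∣q∣ (λ y∈p → subst (_∈ ⁅ x ⁆) (unique x∈p y∈p) (x∈⁅x⁆ x)))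
                              (≤-reflexive (∣⁅x⁆∣≡1 x))
... | no  empty     = subst (_≤ 1) (≡.sym (trans (cong ∣_∣ (Empty-unique empty)) (∣⊥∣≡0 n))) z≤n

p⊆q∧x∈q⇒p∪⁅x⁆⊆q : p ⊆ q → x ∈ q → p ∪ ⁅ x ⁆ ⊆ q
p⊆q∧x∈q⇒p∪⁅x⁆⊆q {p = p} p⊆q x∈q z∈p∪x with x∈p∪q⁻ p _ z∈p∪x
... | inj₁ z∈p = p⊆q z∈p
... | inj₂ z∈x = subst (_∈ _) (≡.sym (x∈⁅y⁆⇒x≡y _ z∈x)) x∈q

∈-tabulate⁺ : ∀ {f : Fin n → Bool} → T (f x) → x ∈ tabulate f
∈-tabulate⁺ {x = x} {f} fx = lookup⇒[]= x _ (trans (lookup∘tabulate f x) (Equivalence.to T-≡ fx))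

∈-tabulate⁻ : ∀ {f : Fin n → Bool} → x ∈ tabulate f → T (f x)
∈-tabulate⁻ {x = x} {f} x∈f = subst T (trans (≡.sym ([]=⇒lookup x∈f)) (lookup∘tabulate f x)) _

countV≡∣tabulate∣ : (f : Fin n → Bool) → countV f ≡ ∣ tabulate f ∣
countV≡∣tabulate∣ {n} f = trans (count-toList (allFin n)) (cong ∣_∣ (≡.sym (tabulate-allFin f)))
  where
    count-toList : ∀ {m} (xs : Vec (Fin n) m) →
                   sum (map (λ v → if f v then 1 else 0) (toList xs)) ≡ ∣ Vec.map f xs ∣
    count-toList []       = refl
    count-toList (x ∷ xs) with f x
    ... | true  = cong suc (count-toList xs)
    ... | false = count-toList xs

tabulate-∩ : ∀ (f : Fin n → Bool) (S : Subset n) → tabulate f ∩ S ≡ tabulate (λ u → f u ∧ lookup S u)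
tabulate-∩ f []      = refl
tabulate-∩ f (b ∷ S) = cong (f Fin.zero ∧ b ∷_) (tabulate-∩ (λ u → f (Fin.suc u)) S)

nbhd : Graph n → Fin n → Subset n
nbhd G v = tabulate (adj G v)

deg≡∣nbhd∣ : ∀ (G : Graph n) v → deg G v ≡ ∣ nbhd G v ∣
deg≡∣nbhd∣ G v = countV≡∣tabulate∣ (adj G v)

nbrsIn≡∣nbhd∩S∣ : ∀ (G : Graph n) S v → nbrsIn G S v ≡ ∣ nbhd G v ∩ S ∣
nbrsIn≡∣nbhd∩S∣ G S v =
  trans (countV≡∣tabulate∣ (λ u → adj G v u ∧ lookup S u)) (cong ∣_∣ (≡.sym (tabulate-∩ (adj G v) S)))

∈-step⁻ : ∀ {r} (G : Graph n) S → x ∈ step r G S → x ∈ S ⊎ r ≤ nbrsIn G S x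
∈-step⁻ {r = r} G S x∈ with Equivalence.to T-∨ (∈-tabulate⁻ x∈)
... | inj₁ x∈S = inj₁ (lookup⇒[]= _ S (Equivalence.to T-≡ x∈S))
... | inj₂ r≤  = inj₂ (≤ᵇ⇒≤ r _ r≤)

-- Inductively, a vertex of S outside A never has more than d + ∣ A ∩ S ∣ infected neighbours.
module Trapped {n} (G : Graph n) (r d : ℕ) {S : Subset n}
               (exits : ∀ {v} → v ∈ S → ∣ nbhd G v ∩ ∁ S ∣ ≤ d) where

  stage∩S⊆A : ∀ A → d + ∣ A ∩ S ∣ < r → ∀ t → stage r G A t ∩ S ⊆ A
  stage∩S⊆A A few zero    v∈ = proj₁ (x∈p∩q⁻ A S v∈)
  stage∩S⊆A A few (suc t) {v} v∈ with x∈p∩q⁻ _ S v∈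
  ... | v∈step , v∈S with ∈-step⁻ G (stage r G A t) v∈step
  ...   | inj₁ v∈B = stage∩S⊆A A few t (x∈p∩q⁺ (v∈B , v∈S))
  ...   | inj₂ r≤  = contradiction (≤-trans r≤ nbrs≤) (<⇒≱ few)
    where
      B : Subset n
      B = stage r G A t
      nbhd∩B⊆ : nbhd G v ∩ B ⊆ (nbhd G v ∩ ∁ S) ∪ (B ∩ S)
      nbhd∩B⊆ {u} u∈ with x∈p∩q⁻ _ B u∈ | u ∈? S
      ... | u∈N , u∈B | yes u∈S = x∈p∪q⁺ (inj₂ (x∈p∩q⁺ (u∈B , u∈S)))
      ... | u∈N , u∈B | no  u∉S = x∈p∪q⁺ (inj₁ (x∈p∩q⁺ (u∈N , x∉p⇒x∈∁p u∉S)))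
      nbrs≤ : nbrsIn G B v ≤ d + ∣ A ∩ S ∣
      nbrs≤ = begin
        nbrsIn G B v                          ≡⟨ nbrsIn≡∣nbhd∩S∣ G B v ⟩
        ∣ nbhd G v ∩ B ∣                      ≤⟨ p⊆q⇒∣p∣≤∣q∣ nbhd∩B⊆ ⟩
        ∣ (nbhd G v ∩ ∁ S) ∪ (B ∩ S) ∣        ≤⟨ ∣p∪q∣≤∣p∣+∣q∣ (nbhd G v ∩ ∁ S) (B ∩ S) ⟩
        ∣ nbhd G v ∩ ∁ S ∣ + ∣ B ∩ S ∣        ≤⟨ +-mono-≤ (exits v∈S) (p⊆q⇒∣p∣≤∣q∣ B∩S⊆A∩S) ⟩
        d + ∣ A ∩ S ∣                         ∎
        where
          open ≤-Reasoning
          B∩S⊆A∩S : B ∩ S ⊆ A ∩ S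
          B∩S⊆A∩S u∈ = x∈p∩q⁺ (stage∩S⊆A A few t u∈ , proj₂ (x∈p∩q⁻ B S u∈))

  percolating-meets : ∀ A → Percolates r G A → r ≤ d + ∣ S ∣ → r ≤ d + ∣ A ∩ S ∣
  percolating-meets A perc r≤d+∣S∣ with r ≤? d + ∣ A ∩ S ∣
  ... | yes r≤ = r≤
  ... | no  r≰ = ≤-trans r≤d+∣S∣ (+-monoʳ-≤ d (p⊆q⇒∣p∣≤∣q∣ S⊆A∩S))
    where
      S⊆A∩S : S ⊆ A ∩ S
      S⊆A∩S {v} v∈S with perc v
      ... | t , v∈Aₜ = x∈p∩q⁺ (stage∩S⊆A A (≰⇒> r≰) t (x∈p∩q⁺ (v∈Aₜ , v∈S)) , v∈S)

∣lowerSegment∣≡ : ∀ {n} k → k ≤ n → ∣ tabulate {n} (λ v → toℕ v <ᵇ k) ∣ ≡ k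
∣lowerSegment∣≡ {zero}  zero    _         = refl
∣lowerSegment∣≡ {suc n} zero    _         = ∣lowerSegment∣≡ {n} zero z≤n
∣lowerSegment∣≡ {suc n} (suc k) (s≤s k≤n) = cong suc (∣lowerSegment∣≡ {n} k k≤n)

module TwoCliques {n k : ℕ} (k+k≤n : k + k ≤ n) where

  lower : Subset n
  lower = tabulate (λ v → toℕ v <ᵇ k)

  upper : Subset n
  upper = ∁ lower

  k≤n : k ≤ n
  k≤n = m+n≤o⇒m≤o k k+k≤n

  ∣lower∣≡k : ∣ lower ∣ ≡ k
  ∣lower∣≡k = ∣lowerSegment∣≡ k k≤n

  ∣upper∣≡n∸k : ∣ upper ∣ ≡ n ∸ k
  ∣upper∣≡n∸k = trans (∣∁p∣≡n∸∣p∣ lower) (cong (n ∸_) ∣lower∣≡k)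

  k≤∣upper∣ : k ≤ ∣ upper ∣
  k≤∣upper∣ = subst (k ≤_) (≡.sym ∣upper∣≡n∸k) (m+n≤o⇒m≤o∸n k k+k≤n)

  ∈lower⁺ : ∀ {v} → toℕ v < k → v ∈ lower
  ∈lower⁺ v<k = ∈-tabulate⁺ (<⇒<ᵇ v<k)

  ∈lower⁻ : ∀ {v} → v ∈ lower → toℕ v < k
  ∈lower⁻ {v} v∈ = <ᵇ⇒< (toℕ v) k (∈-tabulate⁻ v∈)

  ∈upper⁺ : ∀ {v} → k ≤ toℕ v → v ∈ upper
  ∈upper⁺ k≤v = x∉p⇒x∈∁p (λ v∈ → <⇒≱ (∈lower⁻ v∈) k≤v)

  ∈upper⁻ : ∀ {v} → v ∈ upper → k ≤ toℕ v
  ∈upper⁻ v∈ = ≮⇒≥ (x∈∁p⇒x∉p v∈ ∘ ∈lower⁺)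

  lower≢upper : ∀ {u v} → u ∈ lower → v ∈ upper → u ≢ v
  lower≢upper u∈ v∈ refl = x∈∁p⇒x∉p v∈ u∈

  SameSide : Fin n → Fin n → Set
  SameSide u v = (u ∈ lower × v ∈ lower) ⊎ (u ∈ upper × v ∈ upper)

  Matched : Fin n → Fin n → Set
  Matched u v = toℕ v ≡ toℕ u + k ⊎ toℕ u ≡ toℕ v + k

  Adjacent : Fin n → Fin n → Set
  Adjacent u v = u ≢ v × (SameSide u v ⊎ Matched u v)

  adjacent? : ∀ u v → Dec (Adjacent u v)
  adjacent? u v = ¬? (u ≟ v) ×-dec
    (((u ∈? lower ×-dec v ∈? lower) ⊎-dec (u ∈? upper ×-dec v ∈? upper))
     ⊎-dec (toℕ v ℕ.≟ toℕ u + k ⊎-dec toℕ u ℕ.≟ toℕ v + k))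

  adjacent-sym : ∀ {u v} → Adjacent u v → Adjacent v u
  adjacent-sym (u≢v , side) = u≢v ∘ ≡.sym , Sum.map (Sum.map swap swap) Sum.swap side

  twoCliques : Graph n
  twoCliques = record
    { adj    = λ u v → isYes (adjacent? u v)
    ; sym    = λ u v → trans (isYes≗does (adjacent? u v))
                        (trans (does-⇔ (mk⇔ adjacent-sym adjacent-sym) (adjacent? u v) (adjacent? v u))
                               (≡.sym (isYes≗does (adjacent? v u))))
    ; irrefl = λ v → trans (isYes≗does (adjacent? v v)) (dec-false (adjacent? v v) (λ (v≢v , _) → v≢v refl))
    }

  N : Fin n → Subset n
  N = nbhd twoCliques

  ∈N⁺ : ∀ {u v} → Adjacent u v → v ∈ N u
  ∈N⁺ {u} {v} a = ∈-tabulate⁺ (fromWitness {a? = adjacent? u v} a)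

  ∈N⁻ : ∀ {u v} → v ∈ N u → Adjacent u v
  ∈N⁻ {u} {v} v∈ = toWitness {a? = adjacent? u v} (∈-tabulate⁻ v∈)

  crossing : ∀ {u v} → u ∈ lower → v ∈ upper → Adjacent u v → toℕ v ≡ toℕ u + k
  crossing u∈ v∈ (_ , inj₁ (inj₁ (_ , v∈lower))) = contradiction v∈lower (x∈∁p⇒x∉p v∈)
  crossing u∈ v∈ (_ , inj₁ (inj₂ (u∈upper , _))) = contradiction u∈ (x∈∁p⇒x∉p u∈upper)
  crossing u∈ v∈ (_ , inj₂ (inj₁ v≡u+k))          = v≡u+k
  crossing {v = v} u∈ v∈ (_ , inj₂ (inj₂ u≡v+k))  =
    contradiction (subst (k ≤_) (≡.sym u≡v+k) (m≤n+m k (toℕ v))) (<⇒≱ (∈lower⁻ u∈))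

  lower-exits : ∀ {u} → u ∈ lower → ∣ N u ∩ ∁ lower ∣ ≤ 1
  lower-exits {u} u∈ = ∣p∣≤1 λ x∈ y∈ → toℕ-injective (trans (mate x∈) (≡.sym (mate y∈)))
    where
      mate : ∀ {x} → x ∈ N u ∩ ∁ lower → toℕ x ≡ toℕ u + k
      mate x∈ with x∈p∩q⁻ (N u) _ x∈
      ... | x∈N , x∈upper = crossing u∈ x∈upper (∈N⁻ x∈N)

  upper-exits : ∀ {u} → u ∈ upper → ∣ N u ∩ ∁ upper ∣ ≤ 1
  upper-exits {u} u∈ = ∣p∣≤1 λ x∈ y∈ → toℕ-injective (+-cancelʳ-≡ k _ _ (trans (mate x∈) (≡.sym (mate y∈))))
    where
      mate : ∀ {x} → x ∈ N u ∩ ∁ upper → toℕ x + k ≡ toℕ u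
      mate x∈ with x∈p∩q⁻ (N u) _ x∈
      ... | x∈N , x∉upper =
        ≡.sym (crossing (x∉∁p⇒x∈p (x∈∁p⇒x∉p x∉upper)) u∈ (adjacent-sym (∈N⁻ x∈N)))

  side⊆N∪self : ∀ {p u} → (∀ {v} → v ∈ p → v ≢ u → Adjacent u v) → p ⊆ N u ∪ ⁅ u ⁆
  side⊆N∪self {u = u} adjacent {v} v∈p with v ≟ u
  ... | yes refl = x∈p∪q⁺ (inj₂ (x∈⁅x⁆ u))
  ... | no  v≢u  = x∈p∪q⁺ (inj₁ (∈N⁺ (adjacent v∈p v≢u)))

  u+k<n : ∀ {u} → u ∈ lower → toℕ u + k < n
  u+k<n u∈ = <-≤-trans (+-monoˡ-< k (∈lower⁻ u∈)) k+k≤n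

  mate↑ : ∀ {u} → u ∈ lower → Fin n
  mate↑ u∈ = fromℕ< (u+k<n u∈)

  mate↑∈upper : ∀ {u} (u∈ : u ∈ lower) → mate↑ u∈ ∈ upper
  mate↑∈upper {u} u∈ =
    ∈upper⁺ (subst (k ≤_) (≡.sym (toℕ-fromℕ< (u+k<n u∈))) (m≤n+m k (toℕ u)))

  adjacent-mate↑ : ∀ {u} (u∈ : u ∈ lower) → Adjacent u (mate↑ u∈)
  adjacent-mate↑ u∈ =
    lower≢upper u∈ (mate↑∈upper u∈) , inj₂ (inj₁ (toℕ-fromℕ< (u+k<n u∈)))

  u∸k<n : ∀ u → toℕ u ∸ k < n
  u∸k<n u = ≤-<-trans (m∸n≤m (toℕ u) k) (toℕ<n u)

  mate↓ : Fin n → Fin n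
  mate↓ u = fromℕ< (u∸k<n u)

  mate↓∈lower : ∀ {u} → u ∈ upper → toℕ u < k + k → mate↓ u ∈ lower
  mate↓∈lower {u} u∈ u<k+k = ∈lower⁺ (subst (_< k) (≡.sym (toℕ-fromℕ< (u∸k<n u)))
    (subst (toℕ u ∸ k <_) (m+n∸n≡m k k) (∸-monoˡ-< u<k+k (∈upper⁻ u∈))))

  adjacent-mate↓ : ∀ {u} → u ∈ upper → toℕ u < k + k → Adjacent u (mate↓ u)
  adjacent-mate↓ {u} u∈ u<k+k =
    lower≢upper (mate↓∈lower u∈ u<k+k) u∈ ∘ ≡.sym ,
    inj₂ (inj₂ (trans (≡.sym (m∸n+n≡m (∈upper⁻ u∈))) (cong (_+ k) (≡.sym (toℕ-fromℕ< (u∸k<n u))))))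

  u∉N : ∀ u → u ∉ N u
  u∉N u u∈ = proj₁ (∈N⁻ u∈) refl

  lower⇒deg≡k : ∀ {u} → u ∈ lower → deg twoCliques u ≡ k
  lower⇒deg≡k {u} u∈ = trans (deg≡∣nbhd∣ twoCliques u) (≤-antisym ∣N∣≤k k≤∣N∣)
    where
      k≤∣N∣ : k ≤ ∣ N u ∣
      k≤∣N∣ = subst (_≤ ∣ N u ∣) ∣lower∣≡k (p∪⁅x⁆⊆q∪⁅y⁆⇒∣p∣≤∣q∣ (x∈∁p⇒x∉p (mate↑∈upper u∈))
        (p⊆q∧x∈q⇒p∪⁅x⁆⊆q (side⊆N∪self λ v∈ v≢u → v≢u ∘ ≡.sym , inj₁ (inj₁ (u∈ , v∈)))
              (x∈p∪q⁺ (inj₁ (∈N⁺ (adjacent-mate↑ u∈))))))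
      N⊆lower∪mate : N u ⊆ lower ∪ ⁅ mate↑ u∈ ⁆
      N⊆lower∪mate {v} v∈N with v ∈? lower
      ... | yes v∈lower = x∈p∪q⁺ (inj₁ v∈lower)
      ... | no  v∉lower = x∈p∪q⁺ (inj₂ (subst (_∈ ⁅ mate↑ u∈ ⁆) (≡.sym v≡mate) (x∈⁅x⁆ _)))
        where
          v≡mate : v ≡ mate↑ u∈
          v≡mate = toℕ-injective (trans (crossing u∈ (x∉p⇒x∈∁p v∉lower) (∈N⁻ v∈N))
                                        (≡.sym (toℕ-fromℕ< (u+k<n u∈))))
      ∣N∣≤k : ∣ N u ∣ ≤ k
      ∣N∣≤k = subst (∣ N u ∣ ≤_) ∣lower∣≡k
        (p∪⁅x⁆⊆q∪⁅y⁆⇒∣p∣≤∣q∣ (u∉N u) (p⊆q∧x∈q⇒p∪⁅x⁆⊆q N⊆lower∪mate (x∈p∪q⁺ (inj₁ u∈))))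

  upper⇒k≤deg : ∀ {u} → u ∈ upper → k ≤ deg twoCliques u
  upper⇒k≤deg {u} u∈ = subst (k ≤_) (≡.sym (deg≡∣nbhd∣ twoCliques u)) k≤∣N∣
    where
      upper⊆N∪self : upper ⊆ N u ∪ ⁅ u ⁆
      upper⊆N∪self = side⊆N∪self λ v∈ v≢u → v≢u ∘ ≡.sym , inj₁ (inj₂ (u∈ , v∈))
      k≤∣N∣ : k ≤ ∣ N u ∣
      k≤∣N∣ with toℕ u <? k + k
      ... | yes u<k+k = ≤-trans k≤∣upper∣ (p∪⁅x⁆⊆q∪⁅y⁆⇒∣p∣≤∣q∣
              (x∈p⇒x∉∁p (mate↓∈lower u∈ u<k+k))
              (p⊆q∧x∈q⇒p∪⁅x⁆⊆q upper⊆N∪self (x∈p∪q⁺ (inj₁ (∈N⁺ (adjacent-mate↓ u∈ u<k+k))))))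
      -- here n is odd and u = n - 1, so the upper clique has k + 1 vertices
      ... | no  u≮k+k = s≤s⁻¹ (≤-trans 1+k≤∣upper∣ (p⊆q∪⁅x⁆⇒∣p∣≤1+∣q∣ upper⊆N∪self))
        where
          1+k≤∣upper∣ : suc k ≤ ∣ upper ∣
          1+k≤∣upper∣ = subst (suc k ≤_) (≡.sym ∣upper∣≡n∸k)
            (m+n≤o⇒m≤o∸n (suc k) (<-≤-trans (s≤s (≮⇒≥ u≮k+k)) (toℕ<n u)))

  k≤deg : ∀ u → k ≤ deg twoCliques u
  k≤deg u = by-side (u ∈? lower)
    where
      by-side : Dec (u ∈ lower) → k ≤ deg twoCliques u
      by-side (yes u∈) = ≤-reflexive (≡.sym (lower⇒deg≡k u∈))
      by-side (no  u∉) = upper⇒k≤deg (x∉p⇒x∈∁p u∉)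

  minDegree : 0 < k → MinDegree twoCliques k
  minDegree 0<k = k≤deg , z , lower⇒deg≡k (∈lower⁺ (subst (_< k) (≡.sym (toℕ-fromℕ< 0<n)) 0<k))
    where
      0<n : 0 < n
      0<n = <-≤-trans 0<k k≤n
      z : Fin n
      z = fromℕ< 0<n

  perc-number>3 : 2 ≤ k → PercNumberGreaterThan twoCliques 3 3
  perc-number>3 2≤k A perc = begin
    4                              ≤⟨ +-mono-≤ (meets lower-exits (s≤s (subst (2 ≤_) (≡.sym ∣lower∣≡k) 2≤k)))
                                               (meets upper-exits (s≤s (≤-trans 2≤k k≤∣upper∣))) ⟩
    ∣ A ∩ lower ∣ + ∣ A ∩ upper ∣  ≡⟨ ∣p∣≡∣p∩q∣+∣p∩∁q∣ A lower ⟨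
    ∣ A ∣                          ∎
    where
      open ≤-Reasoning
      meets : ∀ {S} → (∀ {v} → v ∈ S → ∣ N v ∩ ∁ S ∣ ≤ 1) → 3 ≤ 1 + ∣ S ∣ → 2 ≤ ∣ A ∩ S ∣
      meets exits 3≤1+∣S∣ = s≤s⁻¹ (Trapped.percolating-meets twoCliques 3 1 exits A perc 3≤1+∣S∣)

corollary2p4 : ∀ (n : ℕ) → 4 ≤ n →
    Σ (Graph n) λ G → MinDegree G (n / 2) × PercNumberGreaterThan G 3 3
corollary2p4 n 4≤n = twoCliques , minDegree (≤-trans (s≤s z≤n) 2≤k) , perc-number>3 2≤k
  where
    2≤k : 2 ≤ n / 2
    2≤k = /-mono-≤ {o = 2} {p = 2} 4≤n ≤-refl
    k+k≤n : n / 2 + n / 2 ≤ n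
    k+k≤n = subst (_≤ n) (trans (*-comm (n / 2) 2) (cong (n / 2 +_) (+-identityʳ (n / 2)))) (m/n*n≤m n 2)
    open TwoCliques {n} {n / 2} k+k≤n
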